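{- Let $n \geq 2$, $m \in \mathbb{N}$, and let $G_1,\ldots,G_n$ be vertex-disjoint graphs with $u_i \in V(G_i)$ for each $i \in [n]$. For each $i$, let $\mathcal{H}_i=(L_i,H_i)$ be an $m$-fold cover of $G_i$ with $L_i(x)=\{(x,j): j \in [m]\}$ for all $x \in V(G_i)$. For each $2 \leq i \leq n$ let $f_i: L_1(u_1) \to L_i(u_i)$ be a bijection, and let $F=(f_2,\ldots,f_n)$. Let $G$ be the graph obtained by identifying $u_1,\ldots,u_n$ as a single vertex $u$, and let $\mathcal{H}$ be the $F$-amalgamated $m$-fold cover of $G$ obtained from $\mathcal{H}_1,\ldots,\mathcal{H}_n$. Let \[ D = \sum_{j=1}^{m} \left( N((u_1,j),\mathcal{H}_1) \prod_{i=2}^{n} N(f_i((u_1,j)),\mathcal{H}_i) \right). \] Then $P_{DP}(G,\mathcal{H}) = D$. Consequently, $P_{DP}(G,m) \leq D$.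
   Context: All graphs are finite and simple. A cover of a graph $G$ is a pair $\mathcal{H}=(L,H)$ where $H$ is a graph and $L: V(G) \to \mathcal{P}(V(H))$ satisfies: (1) $\{L(u): u \in V(G)\}$ is a partition of $V(H)$ into $|V(G)|$ parts; (2) $H[L(u)]$ is complete for each $u$; (3) if there is an edge of $H$ between $L(u)$ and $L(v)$ with $u \neq v$, then $uv \in E(G)$; (4) if $uv \in E(G)$, the edges of $H$ between $L(u)$ and $L(v)$ form a (possibly empty) matching. The cover is $m$-fold if $|L(u)|=m$ for all $u$. An $\mathcal{H}$-coloring of $G$ is an independent set of $H$ of size $|V(G)|$; $P_{DP}(G,\mathcal{H})$ is the number of $\mathcal{H}$-colorings, and $P_{DP}(G,m)$ is its minimum over all $m$-fold covers. For $S \subseteq V(H)$, $N(S,\mathcal{H})$ is the number of $\mathcal{H}$-colorings containing $S$, and $N(s,\mathcal{H}) = N(\{s\},\mathcal{H})$. The $F$-amalgamated $m$-fold cover $\mathcal{H}=(L,H)$ of $G$ obtained from $\mathcal{H}_1,\ldots,\mathcal{H}_n$ is defined as follows: $L(x)=\{(x,j): j \in [m]\}$ for each $x \in V(G)$ and $V(H)=\bigcup_x L(x)$; $H[L(u)]$ is complete; $H$ contains every edge of every $H_i$ that is not incident to a vertex of $L_i(u_i)$; for each $s \in [m]$, $H$ contains the edge $(x,r)(u,s)$ whenever $(x,r)(u_1,s) \in E(H_1)$ with $(x,r) \notin L_1(u_1)$, and, for each $2 \leq i \leq n$, whenever $(x,r)f_i((u_1,s)) \in E(H_i)$ with $(x,r)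 \notin L_i(u_i)$; $H$ has no other edges. -}

module Defs where

open import Data.Nat using (ℕ; zero; suc; _+_; _*_; _≤_)
open import Data.Bool using (Bool; true; false; _∧_; not; if_then_else_)
open import Data.Fin using (Fin; zero; suc; splitAt; punchIn)
open import Data.Fin.Properties using (_≟_)
open import Data.Vec using (Vec; []; _∷_; lookup)
open import Data.List using (List; []; _∷_; map; _++_; filter; length; concatMap)
open import Data.Product using (Σ; _,_; _×_)
open import Data.Sum using (inj₁; inj₂)
open import Data.Maybe using (Maybe; just; nothing)
open import Function using (_∘_)
open import Function.Bundles using (_↔_; Inverse)
open import Relation.Nullary using (¬_; yes; no)
open import Relation.Binary.PropositionalEquality using (_≡_; refl)
open import Relation.Nullary.Decidable using (does)
open import Data.Bool using (T)
open import Data.Bool.Properties using (T?)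

∑ : ∀ n → (Fin n → ℕ) → ℕ
∑ zero    f = 0
∑ (suc n) f = f zero + ∑ n (f ∘ suc)

∏ : ∀ n → (Fin n → ℕ) → ℕ
∏ zero    f = 1
∏ (suc n) f = f zero * ∏ n (f ∘ suc)

allB : ∀ n → (Fin n → Bool) → Bool
allB zero    p = true
allB (suc n) p = p zero ∧ allB n (p ∘ suc)

record Graph (v : ℕ) : Set where
  field adj : Fin v → Fin v → Bool
open Graph public

record IsSimple {v : ℕ} (G : Graph v) : Set where
  field
    sym     : ∀ x y → adj G x y ≡ adj G y x
    irrefl  : ∀ x → adj G x x ≡ false

-- m-fold covers with the canonical labelling L(x) = {(x,j) : j ∈ [m]}.

record CoverGraph (k m : ℕ) : Set where
  field hadj : Fin k → Fin m → Fin k → Fin m → Bool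
open CoverGraph public

record IsCover {k : ℕ} (G : Graph k) (m : ℕ) (H : CoverGraph k m) : Set where
  field
    sym      : ∀ x j y l → hadj H x j y l ≡ hadj H y l x j
    irrefl   : ∀ x j → hadj H x j x j ≡ false
    clique   : ∀ x j l → ¬ j ≡ l → hadj H x j x l ≡ true
    edgeG    : ∀ x j y l → ¬ x ≡ y → hadj H x j y l ≡ true → adj G x y ≡ true
    -- (4) edges between L(x) and L(y), x ≠ y, form a matching
    --     (with sym, this also gives uniqueness on the other side)
    matching : ∀ x j y l l′ → ¬ x ≡ y →
               hadj H x j y l ≡ true → hadj H x j y l′ ≡ true → l ≡ l′

-- Subsets of V(H) = Fin k × Fin m, as k rows of Boolean vectors of length m.

subsetsOf : ∀ m → List (Vec Bool m)
subsetsOf zero    = [] ∷ []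
subsetsOf (suc m) = map (true ∷_) (subsetsOf m) ++ map (false ∷_) (subsetsOf m)

vecsOf : ∀ {A : Set} → List A → ∀ k → List (Vec A k)
vecsOf xs zero    = [] ∷ []
vecsOf xs (suc k) = concatMap (λ x → map (x ∷_) (vecsOf xs k)) xs

-- all subsets of V(H) (each exactly once)
allSubsets : ∀ k m → List (Vec (Vec Bool m) k)
allSubsets k m = vecsOf (subsetsOf m) k

mem : ∀ {k m} → Vec (Vec Bool m) k → Fin k → Fin m → Bool
mem S x j = lookup (lookup S x) j

bcount : ∀ m → (Fin m → Bool) → ℕ
bcount zero    p = 0
bcount (suc m) p = (if p zero then 1 else 0) + bcount m (p ∘ suc)

size : ∀ {k m} → Vec (Vec Bool m) k → ℕ
size {k} {m} S = ∑ k (λ x → bcount m (mem S x))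

independent : ∀ {k m} → CoverGraph k m → Vec (Vec Bool m) k → Bool
independent {k} {m} H S =
  allB k λ x → allB m λ j → allB k λ y → allB m λ l →
    not (mem S x j ∧ mem S y l ∧ hadj H x j y l)

_==_ : ℕ → ℕ → Bool
a == b = does (a Data.Nat.≟ b)

isColoring : ∀ {k m} → CoverGraph k m → Vec (Vec Bool m) k → Bool
isColoring {k} H S = independent H S ∧ (size S == k)

colorings : ∀ {k m} → CoverGraph k m → List (Vec (Vec Bool m) k)
colorings {k} {m} H = filter (λ S → T? (isColoring H S)) (allSubsets k m)

PDP : ∀ {k m} → CoverGraph k m → ℕ
PDP H = length (colorings H)

Nv : ∀ {k m} → CoverGraph k m → Fin k → Fin m → ℕ
Nv H x j = length (filter (λ S → T? (mem S x j)) (colorings H))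

-- "P_DP(G, m) ≤ d": the minimum over all m-fold covers of G of the number of
-- colorings is at most d, i.e. some m-fold cover has at most d colorings.
-- (Every m-fold cover is isomorphic to one with the canonical labelling.)
PDPm≤ : ∀ {k} → Graph k → ℕ → ℕ → Set
PDPm≤ G m d = Σ (CoverGraph _ m) λ H → IsCover G m H × PDP H ≤ d

-- The vertices of G_i other
-- than u_i are punchIn u_i y for y : Fin (k i).
-- The glued graph G has vertex set Fin (suc (∑ N k)): zero is the identified
-- vertex u, and suc a encodes the pair (i , y) (vertex punchIn u_i y of G_i),
-- the blocks Fin (k i) being laid out consecutively.

split : ∀ N (k : Fin N → ℕ) → Fin (∑ N k) → Σ (Fin N) λ i → Fin (k i)
split (suc N) k a with splitAt (k zero) a
... | inj₁ y = zero , y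
... | inj₂ b with split N (k ∘ suc) b
...   | i , z = suc i , z

decode : ∀ N (k : Fin N → ℕ) → Fin (suc (∑ N k)) → Maybe (Σ (Fin N) λ i → Fin (k i))
decode N k zero    = nothing
decode N k (suc a) = just (split N k a)

gluedAdj : ∀ N (k : Fin N → ℕ) (G : (i : Fin N) → Graph (suc (k i)))
           (u : (i : Fin N) → Fin (suc (k i))) →
           Maybe (Σ (Fin N) λ i → Fin (k i)) → Maybe (Σ (Fin N) λ i → Fin (k i)) → Bool
gluedAdj N k G u nothing        nothing        = false
gluedAdj N k G u (just (i , y)) nothing        = adj (G i) (punchIn (u i) y) (u i)
gluedAdj N k G u nothing        (just (i , y)) = adj (G i) (u i) (punchIn (u i) y)
gluedAdj N k G u (just (i , y)) (just (j , z)) with i ≟ j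
... | yes refl = adj (G i) (punchIn (u i) y) (punchIn (u i) z)
... | no _     = false

glue : ∀ N (k : Fin N → ℕ) (G : (i : Fin N) → Graph (suc (k i)))
       (u : (i : Fin N) → Fin (suc (k i))) → Graph (suc (∑ N k))
glue N k G u = record { adj = λ a b → gluedAdj N k G u (decode N k a) (decode N k b) }

-- The F-amalgamated cover.  Graphs are indexed by Fin (suc r): index zero is
-- G_1 and index suc i is G_{i+2}; f i : [m] ↔ [m] is f_{i+2}, where
-- f_{i+2}((u_1, s)) = (u_{i+2}, f i s).

gF : ∀ {r m} → (Fin r → Fin m ↔ Fin m) → Fin (suc r) → Fin m → Fin m
gF f zero    s = s
gF f (suc i) s = Inverse.to (f i) s

amalgAdj : ∀ r m (k : Fin (suc r) → ℕ) (u : (i : Fin (suc r)) → Fin (suc (k i)))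
           (H : (i : Fin (suc r)) → CoverGraph (suc (k i)) m)
           (f : Fin r → Fin m ↔ Fin m) →
           Maybe (Σ (Fin (suc r)) λ i → Fin (k i)) → Fin m →
           Maybe (Σ (Fin (suc r)) λ i → Fin (k i)) → Fin m → Bool
amalgAdj r m k u H f nothing r′ nothing s = not (does (r′ ≟ s))
-- edges (x,r)(u,s) from (x,r) f_i((u_1,s)) ∈ E(H_i)
amalgAdj r m k u H f (just (i , y)) r′ nothing s =
  hadj (H i) (punchIn (u i) y) r′ (u i) (gF f i s)
amalgAdj r m k u H f nothing s (just (i , y)) r′ =
  hadj (H i) (u i) (gF f i s) (punchIn (u i) y) r′
amalgAdj r m k u H f (just (i , y)) r′ (just (j , z)) s with i ≟ j
... | yes refl = hadj (H i) (punchIn (u i) y) r′ (punchIn (u i) z) s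
... | no _     = false

amalgamated : ∀ r m (k : Fin (suc r) → ℕ) (u : (i : Fin (suc r)) → Fin (suc (k i)))
              (H : (i : Fin (suc r)) → CoverGraph (suc (k i)) m)
              (f : Fin r → Fin m ↔ Fin m) → CoverGraph (suc (∑ (suc r) k)) m
amalgamated r m k u H f = record
  { hadj = λ a s b t →
      amalgAdj r m k u H f (decode (suc r) k a) s (decode (suc r) k b) t }

{-# OPTIONS --safe #-}
-- The fibres L(x) are cliques and there are |V(G)| of them, so an H-coloring meets every fibre
-- exactly once: colorings are the choice functions c : V(G) → [m] whose chosen vertices are
-- pairwise non-adjacent in H.  A choice function for the amalgamated cover is a colour s of u
-- together with independent choices on the blocks V(G_i) − u_i, and since every edge of the
-- amalgamated cover comes from a single H_i, it is proper iff for each i the choice on G_i giving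
-- u_i the colour f_i(s) is proper in H_i.  The sum over the blocks therefore factorises into
-- Σ_s ∏_i N((u_i, f_i(s)), H_i) = D.  The amalgamated cover is an m-fold cover of G, so it also
-- witnesses P_DP(G, m) ≤ D.
module Submission where

open import Defs
open import Data.Bool using (Bool; true; false; _∧_; not)
open import Data.Bool.Properties using (T?; ∧-zeroʳ; ∧-identityʳ; not-injective)
open import Data.Empty using (⊥-elim)
open import Data.Fin using (Fin; zero; suc; _↑ˡ_; _↑ʳ_; splitAt; join; punchIn; punchOut)
open import Data.Fin.Properties
  using (_≟_; suc-injective; splitAt-↑ˡ; splitAt-↑ʳ; join-splitAt;
         punchInᵢ≢i; punchIn-punchOut; punchIn-injective)
open import Data.List using (List; []; _∷_; _++_; concatMap; filter; length)
import Data.List as List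
open import Data.Maybe using (Maybe; just; nothing)
open import Data.Nat using (ℕ; zero; suc; _+_; _*_; _≤_; z≤n; s≤s)
import Data.Nat as ℕ
open import Data.Nat.Properties
  using (+-identityʳ; +-assoc; *-zeroʳ; *-comm; *-assoc; *-distribˡ-+; *-distribʳ-+;
         +-mono-≤; ≤-reflexive; 1+n≰n; +-commutativeSemigroup)
open import Algebra.Properties.CommutativeSemigroup +-commutativeSemigroup
  using () renaming (interchange to +-interchange)
open import Data.Product using (Σ; _,_; _×_; uncurry)
open import Data.Sum using (inj₁; inj₂)
open import Data.Vec using (Vec; []; _∷_; lookup; insertAt; map; replicate; take; drop)
open import Data.Vec.Properties using (lookup-map; lookup-replicate; insertAt-lookup; insertAt-punchIn)
open import Function using (_∘_; id)
open import Function.Bundles using (_↔_; Inverse; Injection)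
open import Function.Properties.Inverse using (↔⇒↣)
open import Relation.Binary.PropositionalEquality
open import Relation.Nullary using (¬_; yes; no)
open import Relation.Nullary.Decidable using (does; dec-true; dec-false)

𝟙 : Bool → ℕ
𝟙 true  = 1
𝟙 false = 0

𝟙-∧ : ∀ a b → 𝟙 (a ∧ b) ≡ 𝟙 a * 𝟙 b
𝟙-∧ true  b = sym (+-identityʳ (𝟙 b))
𝟙-∧ false b = refl

bool-ext : ∀ {a b : Bool} → (a ≡ true → b ≡ true) → (b ≡ true → a ≡ true) → a ≡ b
bool-ext {true}  {true}  a⇒b b⇒a = refl
bool-ext {true}  {false} a⇒b b⇒a = sym (a⇒b refl)
bool-ext {false} {true}  a⇒b b⇒a = b⇒a refl
bool-ext {false} {false} a⇒b b⇒a = refl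

allB-elim : ∀ n (p : Fin n → Bool) → allB n p ≡ true → ∀ i → p i ≡ true
allB-elim (suc n) p all zero    with p zero | all
... | true | _ = refl
allB-elim (suc n) p all (suc i) with p zero | all
... | true | all′ = allB-elim n (p ∘ suc) all′ i

allB-intro : ∀ n (p : Fin n → Bool) → (∀ i → p i ≡ true) → allB n p ≡ true
allB-intro zero    p all = refl
allB-intro (suc n) p all rewrite all zero = allB-intro n (p ∘ suc) (all ∘ suc)

𝟙-allB : ∀ n (p : Fin n → Bool) → 𝟙 (allB n p) ≡ ∏ n (𝟙 ∘ p)
𝟙-allB zero    p = refl
𝟙-allB (suc n) p =
  trans (𝟙-∧ (p zero) (allB n (p ∘ suc))) (cong (𝟙 (p zero) *_) (𝟙-allB n (p ∘ suc)))

∑-cong : ∀ n {f g : Fin n → ℕ} → (∀ i → f i ≡ g i) → ∑ n f ≡ ∑ n g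
∑-cong zero    f≡g = refl
∑-cong (suc n) f≡g = cong₂ _+_ (f≡g zero) (∑-cong n (f≡g ∘ suc))

∏-cong : ∀ n {f g : Fin n → ℕ} → (∀ i → f i ≡ g i) → ∏ n f ≡ ∏ n g
∏-cong zero    f≡g = refl
∏-cong (suc n) f≡g = cong₂ _*_ (f≡g zero) (∏-cong n (f≡g ∘ suc))

∑-0 : ∀ n → ∑ n (λ _ → 0) ≡ 0
∑-0 zero    = refl
∑-0 (suc n) = ∑-0 n

∑-distrib-+ : ∀ n (f g : Fin n → ℕ) → ∑ n (λ i → f i + g i) ≡ ∑ n f + ∑ n g
∑-distrib-+ zero    f g = refl
∑-distrib-+ (suc n) f g = begin
  f zero + g zero + ∑ n (λ i → f (suc i) + g (suc i))
    ≡⟨ cong (f zero + g zero +_) (∑-distrib-+ n (f ∘ suc) (g ∘ suc)) ⟩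
  f zero + g zero + (∑ n (f ∘ suc) + ∑ n (g ∘ suc))
    ≡⟨ +-interchange (f zero) (g zero) _ _ ⟩
  f zero + ∑ n (f ∘ suc) + (g zero + ∑ n (g ∘ suc)) ∎
  where open ≡-Reasoning

∑-distribʳ-* : ∀ n (f : Fin n → ℕ) c → ∑ n (λ i → f i * c) ≡ ∑ n f * c
∑-distribʳ-* zero    f c = refl
∑-distribʳ-* (suc n) f c = trans (cong (f zero * c +_) (∑-distribʳ-* n (f ∘ suc) c))
                                 (sym (*-distribʳ-+ c (f zero) (∑ n (f ∘ suc))))

∑-comm : ∀ n m (F : Fin n → Fin m → ℕ) →
         ∑ n (λ i → ∑ m (F i)) ≡ ∑ m (λ j → ∑ n (λ i → F i j))
∑-comm zero    m F = sym (∑-0 m)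
∑-comm (suc n) m F = trans (cong (∑ m (F zero) +_) (∑-comm n m (F ∘ suc)))
                           (sym (∑-distrib-+ m (F zero) (λ j → ∑ n (λ i → F (suc i) j))))

∑L : ∀ {A : Set} → List A → (A → ℕ) → ℕ
∑L []       g = 0
∑L (x ∷ xs) g = g x + ∑L xs g

∑L-cong : ∀ {A : Set} (xs : List A) {f g : A → ℕ} → (∀ x → f x ≡ g x) → ∑L xs f ≡ ∑L xs g
∑L-cong []       f≡g = refl
∑L-cong (x ∷ xs) f≡g = cong₂ _+_ (f≡g x) (∑L-cong xs f≡g)

∑L-0 : ∀ {A : Set} (xs : List A) → ∑L xs (λ _ → 0) ≡ 0
∑L-0 []       = refl
∑L-0 (x ∷ xs) = ∑L-0 xs

∑L-++ : ∀ {A : Set} (xs ys : List A) g → ∑L (xs ++ ys) g ≡ ∑L xs g + ∑L ys g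
∑L-++ []       ys g = refl
∑L-++ (x ∷ xs) ys g = trans (cong (g x +_) (∑L-++ xs ys g)) (sym (+-assoc (g x) _ _))

∑L-map : ∀ {A B : Set} (h : A → B) (xs : List A) g → ∑L (List.map h xs) g ≡ ∑L xs (g ∘ h)
∑L-map h []       g = refl
∑L-map h (x ∷ xs) g = cong (g (h x) +_) (∑L-map h xs g)

∑L-concatMap : ∀ {A B : Set} (h : A → List B) (xs : List A) g →
               ∑L (concatMap h xs) g ≡ ∑L xs (λ x → ∑L (h x) g)
∑L-concatMap h []       g = refl
∑L-concatMap h (x ∷ xs) g = trans (∑L-++ (h x) (concatMap h xs) g)
                                  (cong (∑L (h x) g +_) (∑L-concatMap h xs g))

∑L-distribˡ-* : ∀ {A : Set} (xs : List A) g c → ∑L xs (λ x → c * g x) ≡ c * ∑L xs g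
∑L-distribˡ-* []       g c = sym (*-zeroʳ c)
∑L-distribˡ-* (x ∷ xs) g c = trans (cong (c * g x +_) (∑L-distribˡ-* xs g c))
                                   (sym (*-distribˡ-+ c (g x) _))

length-filter≡∑L : ∀ {A : Set} (p : A → Bool) (xs : List A) →
                   length (filter (T? ∘ p) xs) ≡ ∑L xs (𝟙 ∘ p)
length-filter≡∑L p []       = refl
length-filter≡∑L p (x ∷ xs) with p x
... | true  = cong suc (length-filter≡∑L p xs)
... | false = length-filter≡∑L p xs

∑L-filter : ∀ {A : Set} (p : A → Bool) (xs : List A) g →
            ∑L (filter (T? ∘ p) xs) g ≡ ∑L xs (λ x → 𝟙 (p x) * g x)
∑L-filter p []       g = refl
∑L-filter p (x ∷ xs) g with p x
... | true  = cong₂ _+_ (sym (+-identityʳ (g x))) (∑L-filter p xs g)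
... | false = ∑L-filter p xs g

∑L-vecsOf : ∀ {A : Set} (xs : List A) k g →
            ∑L (vecsOf xs (suc k)) g ≡ ∑L xs (λ x → ∑L (vecsOf xs k) (g ∘ (x ∷_)))
∑L-vecsOf xs k g = trans (∑L-concatMap (λ x → List.map (x ∷_) (vecsOf xs k)) xs g)
                         (∑L-cong xs (λ x → ∑L-map (x ∷_) (vecsOf xs k) g))

∑V : ∀ m k → (Vec (Fin m) k → ℕ) → ℕ
∑V m zero    g = g []
∑V m (suc k) g = ∑ m (λ s → ∑V m k (g ∘ (s ∷_)))

∑V-cong : ∀ m k {f g : Vec (Fin m) k → ℕ} → (∀ c → f c ≡ g c) → ∑V m k f ≡ ∑V m k g
∑V-cong m zero    f≡g = f≡g []
∑V-cong m (suc k) f≡g = ∑-cong m (λ s → ∑V-cong m k (f≡g ∘ (s ∷_)))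

∑V-distribʳ-* : ∀ m k (f : Vec (Fin m) k → ℕ) c → ∑V m k (λ v → f v * c) ≡ ∑V m k f * c
∑V-distribʳ-* m zero    f c = refl
∑V-distribʳ-* m (suc k) f c =
  trans (∑-cong m (λ s → ∑V-distribʳ-* m k (f ∘ (s ∷_)) c))
        (∑-distribʳ-* m (λ s → ∑V m k (f ∘ (s ∷_))) c)

∑V-distribˡ-* : ∀ m k (f : Vec (Fin m) k → ℕ) c → ∑V m k (λ v → c * f v) ≡ c * ∑V m k f
∑V-distribˡ-* m k f c = begin
  ∑V m k (λ v → c * f v)  ≡⟨ ∑V-cong m k (λ v → *-comm c (f v)) ⟩
  ∑V m k (λ v → f v * c)  ≡⟨ ∑V-distribʳ-* m k f c ⟩
  ∑V m k f * c            ≡⟨ *-comm (∑V m k f) c ⟩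
  c * ∑V m k f            ∎
  where open ≡-Reasoning

∑V-insertAt : ∀ m k (i : Fin (suc k)) (g : Vec (Fin m) (suc k) → ℕ) →
              ∑V m (suc k) g ≡ ∑ m (λ x → ∑V m k (λ w → g (insertAt w i x)))
∑V-insertAt m k       zero    g = refl
∑V-insertAt m (suc k) (suc i) g =
  trans (∑-cong m (λ y → ∑V-insertAt m k i (g ∘ (y ∷_))))
        (∑-comm m m (λ y x → ∑V m k (λ w → g (y ∷ insertAt w i x))))

∑V-take-drop : ∀ m a b (g : Vec (Fin m) a → ℕ) (h : Vec (Fin m) b → ℕ) →
               ∑V m (a + b) (λ v → g (take a v) * h (drop a v)) ≡ ∑V m a g * ∑V m b h
∑V-take-drop m zero    b g h = ∑V-distribˡ-* m b h (g [])
∑V-take-drop m (suc a) b g h =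
  trans (∑-cong m (λ s → ∑V-take-drop m a b (g ∘ (s ∷_)) h))
        (∑-distribʳ-* m (λ s → ∑V m a (g ∘ (s ∷_))) (∑V m b h))

-- The blocks V(G_i) − u_i of the glued vertex set

block : ∀ {A : Set} N (k : Fin N → ℕ) (i : Fin N) → Vec A (∑ N k) → Vec A (k i)
block (suc N) k zero    v = take (k zero) v
block (suc N) k (suc i) v = block N (k ∘ suc) i (drop (k zero) v)

∑V-∏-blocks : ∀ m N (k : Fin N → ℕ) (h : (i : Fin N) → Vec (Fin m) (k i) → ℕ) →
              ∑V m (∑ N k) (λ v → ∏ N (λ i → h i (block N k i v))) ≡ ∏ N (λ i → ∑V m (k i) (h i))
∑V-∏-blocks m zero    k h = refl
∑V-∏-blocks m (suc N) k h =
  trans (∑V-take-drop m (k zero) (∑ N (k ∘ suc)) (h zero)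
           (λ w → ∏ N (λ i → h (suc i) (block N (k ∘ suc) i w))))
        (cong (∑V m (k zero) (h zero) *_) (∑V-∏-blocks m N (k ∘ suc) (h ∘ suc)))

unsplit : ∀ N (k : Fin N → ℕ) (i : Fin N) → Fin (k i) → Fin (∑ N k)
unsplit (suc N) k zero    y = y ↑ˡ ∑ N (k ∘ suc)
unsplit (suc N) k (suc i) y = k zero ↑ʳ unsplit N (k ∘ suc) i y

lookup-take : ∀ {A : Set} a b (v : Vec A (a + b)) y → lookup (take a v) y ≡ lookup v (y ↑ˡ b)
lookup-take (suc a) b (x ∷ v) zero    = refl
lookup-take (suc a) b (x ∷ v) (suc y) = lookup-take a b v y

lookup-drop : ∀ {A : Set} a b (v : Vec A (a + b)) y → lookup (drop a v) y ≡ lookup v (a ↑ʳ y)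
lookup-drop zero    b v       y = refl
lookup-drop (suc a) b (x ∷ v) y = lookup-drop a b v y

lookup-block : ∀ {A : Set} N (k : Fin N → ℕ) i (v : Vec A (∑ N k)) y →
               lookup (block N k i v) y ≡ lookup v (unsplit N k i y)
lookup-block (suc N) k zero    v y = lookup-take (k zero) _ v y
lookup-block (suc N) k (suc i) v y =
  trans (lookup-block N (k ∘ suc) i (drop (k zero) v) y)
        (lookup-drop (k zero) _ v (unsplit N (k ∘ suc) i y))

split-unsplit : ∀ N (k : Fin N → ℕ) i y → split N k (unsplit N k i y) ≡ (i , y)
split-unsplit (suc N) k zero y rewrite splitAt-↑ˡ (k zero) y (∑ N (k ∘ suc)) = refl
split-unsplit (suc N) k (suc i) y
  rewrite splitAt-↑ʳ (k zero) (∑ N (k ∘ suc)) (unsplit N (k ∘ suc) i y)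
        | split-unsplit N (k ∘ suc) i y = refl

unsplit-split : ∀ N (k : Fin N → ℕ) a → uncurry (unsplit N k) (split N k a) ≡ a
unsplit-split (suc N) k a with splitAt (k zero) a in e
... | inj₁ y = trans (cong (join (k zero) _) (sym e)) (join-splitAt (k zero) _ a)
... | inj₂ b with split N (k ∘ suc) b in e′
...   | i , z = begin
    k zero ↑ʳ unsplit N (k ∘ suc) i z
      ≡⟨ cong (λ p → k zero ↑ʳ uncurry (unsplit N (k ∘ suc)) p) (sym e′) ⟩
    k zero ↑ʳ uncurry (unsplit N (k ∘ suc)) (split N (k ∘ suc) b)
      ≡⟨ cong (k zero ↑ʳ_) (unsplit-split N (k ∘ suc) b) ⟩
    join (k zero) _ (inj₂ b)
      ≡⟨ cong (join (k zero) _) (sym e) ⟩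
    join (k zero) _ (splitAt (k zero) a)
      ≡⟨ join-splitAt (k zero) _ a ⟩
    a ∎
    where open ≡-Reasoning

does-≟-sym : ∀ {n} (j l : Fin n) → does (j ≟ l) ≡ does (l ≟ j)
does-≟-sym j l with j ≟ l
... | yes refl = sym (dec-true (j ≟ j) refl)
... | no  j≢l  = sym (dec-false (l ≟ j) (j≢l ∘ sym))

data PunchInView {n} (i : Fin (suc n)) : Fin (suc n) → Set where
  at-i    : PunchInView i i
  punched : (y : Fin n) → PunchInView i (punchIn i y)

punchInView : ∀ {n} (i x : Fin (suc n)) → PunchInView i x
punchInView i x with i ≟ x
... | yes refl = at-i
... | no  i≢x  = subst (PunchInView i) (punchIn-punchOut i≢x) (punched (punchOut i≢x))

-- Colorings as choice functions

oneHot : ∀ {m} → Fin m → Vec Bool m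
oneHot {suc m} zero    = true ∷ replicate m false
oneHot         (suc s) = false ∷ oneHot s

lookup-oneHot-self : ∀ {m} (s : Fin m) → lookup (oneHot s) s ≡ true
lookup-oneHot-self zero    = refl
lookup-oneHot-self (suc s) = lookup-oneHot-self s

lookup-oneHot-true : ∀ {m} (s j : Fin m) → lookup (oneHot s) j ≡ true → s ≡ j
lookup-oneHot-true         zero    zero    _ = refl
lookup-oneHot-true {suc m} zero    (suc j) e with () ← trans (sym (lookup-replicate j false)) e
lookup-oneHot-true         (suc s) (suc j) e = cong suc (lookup-oneHot-true s j e)

∑-oneHot : ∀ m (t : Fin m) (F : Fin m → ℕ) → ∑ m (λ s → 𝟙 (lookup (oneHot s) t) * F s) ≡ F t
∑-oneHot (suc m) zero    F =
  trans (cong (F zero + 0 +_) (∑-0 m)) (trans (+-identityʳ _) (+-identityʳ _))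
∑-oneHot (suc m) (suc t) F rewrite lookup-replicate {n = m} t false = ∑-oneHot m t (F ∘ suc)

isEmpty isSingleton : ∀ {m} → Vec Bool m → Bool
isEmpty     {m} R = bcount m (lookup R) == 0
isSingleton {m} R = bcount m (lookup R) == 1

∑L-subsets-empty : ∀ m (h : Vec Bool m → ℕ) →
  ∑L (subsetsOf m) (λ R → 𝟙 (isEmpty R) * h R) ≡ h (replicate m false)
∑L-subsets-empty zero    h = trans (+-identityʳ _) (+-identityʳ _)
∑L-subsets-empty (suc m) h = begin
  ∑L (subsetsOf (suc m)) (λ R → 𝟙 (isEmpty R) * h R)
    ≡⟨ ∑L-++ (List.map (true ∷_) (subsetsOf m)) _ _ ⟩
  ∑L (List.map (true ∷_) (subsetsOf m)) _ + ∑L (List.map (false ∷_) (subsetsOf m)) _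
    ≡⟨ cong₂ _+_ (trans (∑L-map (true ∷_) (subsetsOf m) _) (∑L-0 (subsetsOf m)))
                 (∑L-map (false ∷_) (subsetsOf m) _) ⟩
  ∑L (subsetsOf m) (λ R → 𝟙 (isEmpty R) * h (false ∷ R))
    ≡⟨ ∑L-subsets-empty m (h ∘ (false ∷_)) ⟩
  h (replicate (suc m) false) ∎
  where open ≡-Reasoning

∑L-subsets-singleton : ∀ m (h : Vec Bool m → ℕ) →
  ∑L (subsetsOf m) (λ R → 𝟙 (isSingleton R) * h R) ≡ ∑ m (h ∘ oneHot)
∑L-subsets-singleton zero    h = refl
∑L-subsets-singleton (suc m) h =
  trans (∑L-++ (List.map (true ∷_) (subsetsOf m)) _ _)
        (cong₂ _+_ (trans (∑L-map (true ∷_) (subsetsOf m) _)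
                          (∑L-subsets-empty m (h ∘ (true ∷_))))
                   (trans (∑L-map (false ∷_) (subsetsOf m) _)
                          (∑L-subsets-singleton m (h ∘ (false ∷_)))))

onePerFibre : ∀ {k m} → Vec (Vec Bool m) k → Bool
onePerFibre {k} S = allB k (isSingleton ∘ lookup S)

∑L-onePerFibre : ∀ m k (h : Vec (Vec Bool m) k → ℕ) →
  ∑L (allSubsets k m) (λ S → 𝟙 (onePerFibre S) * h S) ≡ ∑V m k (h ∘ map oneHot)
∑L-onePerFibre m zero    h = trans (+-identityʳ _) (+-identityʳ _)
∑L-onePerFibre m (suc k) h = begin
  ∑L (allSubsets (suc k) m) (λ S → 𝟙 (onePerFibre S) * h S)
    ≡⟨ ∑L-vecsOf (subsetsOf m) k _ ⟩
  ∑L (subsetsOf m) (λ R → ∑L (allSubsets k m) (λ S → 𝟙 (isSingleton R ∧ onePerFibre S) * h (R ∷ S)))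
    ≡⟨ ∑L-cong (subsetsOf m) factor ⟩
  ∑L (subsetsOf m) (λ R → 𝟙 (isSingleton R) * ∑L (allSubsets k m) (λ S → 𝟙 (onePerFibre S) * h (R ∷ S)))
    ≡⟨ ∑L-subsets-singleton m _ ⟩
  ∑ m (λ s → ∑L (allSubsets k m) (λ S → 𝟙 (onePerFibre S) * h (oneHot s ∷ S)))
    ≡⟨ ∑-cong m (λ s → ∑L-onePerFibre m k (h ∘ (oneHot s ∷_))) ⟩
  ∑V m (suc k) (h ∘ map oneHot) ∎
  where
  open ≡-Reasoning
  factor : ∀ R → ∑L (allSubsets k m) (λ S → 𝟙 (isSingleton R ∧ onePerFibre S) * h (R ∷ S))
               ≡ 𝟙 (isSingleton R) * ∑L (allSubsets k m) (λ S → 𝟙 (onePerFibre S) * h (R ∷ S))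
  factor R = trans (∑L-cong (allSubsets k m) (λ S →
                      trans (cong (_* h (R ∷ S)) (𝟙-∧ (isSingleton R) (onePerFibre S)))
                            (*-assoc (𝟙 (isSingleton R)) _ _)))
                   (∑L-distribˡ-* (allSubsets k m) _ (𝟙 (isSingleton R)))

NonAdjacent : ∀ {k m} → CoverGraph k m → Vec (Fin m) k → Set
NonAdjacent H c = ∀ x y → hadj H x (lookup c x) y (lookup c y) ≡ false

proper : ∀ {k m} → CoverGraph k m → Vec (Fin m) k → Bool
proper {k} H c = allB k λ x → allB k λ y → not (hadj H x (lookup c x) y (lookup c y))

proper-elim : ∀ {k m} (H : CoverGraph k m) c → proper H c ≡ true → NonAdjacent H c
proper-elim {k} H c p x y = not-injective (allB-elim k _ (allB-elim k _ p x) y)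

proper-intro : ∀ {k m} (H : CoverGraph k m) c → NonAdjacent H c → proper H c ≡ true
proper-intro {k} H c nonadj = allB-intro k _ λ x → allB-intro k _ λ y → cong not (nonadj x y)

independent-elim : ∀ {k m} (H : CoverGraph k m) S → independent H S ≡ true →
                   ∀ x j y l → not (mem S x j ∧ mem S y l ∧ hadj H x j y l) ≡ true
independent-elim {k} {m} H S ind x j y l =
  allB-elim m _ (allB-elim k _ (allB-elim m _ (allB-elim k _ ind x) j) y) l

independent-intro : ∀ {k m} (H : CoverGraph k m) S →
                    (∀ x j y l → not (mem S x j ∧ mem S y l ∧ hadj H x j y l) ≡ true) →
                    independent H S ≡ true
independent-intro {k} {m} H S free =
  allB-intro k _ λ x → allB-intro m _ λ j → allB-intro k _ λ y → allB-intro m _ λ l → free x j y l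

mem-oneHot : ∀ {k m} (c : Vec (Fin m) k) x j → mem (map oneHot c) x j ≡ lookup (oneHot (lookup c x)) j
mem-oneHot c x j = cong (λ R → lookup R j) (lookup-map x oneHot c)

independent-oneHot : ∀ {k m} (H : CoverGraph k m) (c : Vec (Fin m) k) →
                     independent H (map oneHot c) ≡ proper H c
independent-oneHot {k} {m} H c = bool-ext ⇒ ⇐
  where
  chosen : ∀ x → mem (map oneHot c) x (lookup c x) ≡ true
  chosen x = trans (mem-oneHot c x (lookup c x)) (lookup-oneHot-self (lookup c x))
  ⇒ : independent H (map oneHot c) ≡ true → proper H c ≡ true
  ⇒ ind = proper-intro H c λ x y → not-injective
    (subst (λ b → not b ≡ true)
           (cong₂ (λ a b → a ∧ b ∧ hadj H x (lookup c x) y (lookup c y)) (chosen x) (chosen y))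
           (independent-elim H (map oneHot c) ind x (lookup c x) y (lookup c y)))
  edge-free : proper H c ≡ true → ∀ x j y l →
              not (mem (map oneHot c) x j ∧ mem (map oneHot c) y l ∧ hadj H x j y l) ≡ true
  edge-free p x j y l rewrite mem-oneHot c x j | mem-oneHot c y l
    with lookup (oneHot (lookup c x)) j in xj | lookup (oneHot (lookup c y)) l in yl
  ... | false | _     = refl
  ... | true  | false = refl
  ... | true  | true  = subst₂ (λ a b → not (hadj H x a y b) ≡ true)
    (lookup-oneHot-true _ _ xj) (lookup-oneHot-true _ _ yl) (cong not (proper-elim H c p x y))
  ⇐ : proper H c ≡ true → independent H (map oneHot c) ≡ true
  ⇐ p = independent-intro H (map oneHot c) (edge-free p)

bcount-false : ∀ m (p : Fin m → Bool) → (∀ j → p j ≡ false) → bcount m p ≡ 0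
bcount-false zero    p none = refl
bcount-false (suc m) p none rewrite none zero = bcount-false m (p ∘ suc) (none ∘ suc)

bcount≤1 : ∀ m (p : Fin m → Bool) → (∀ j l → p j ≡ true → p l ≡ true → j ≡ l) → bcount m p ≤ 1
bcount≤1 zero    p unique = z≤n
bcount≤1 (suc m) p unique with p zero in p0
... | true  = s≤s (≤-reflexive (bcount-false m (p ∘ suc) rest-false))
  where
  rest-false : ∀ j → p (suc j) ≡ false
  rest-false j with p (suc j) in pj
  ... | false = refl
  ... | true  with () ← unique zero (suc j) p0 pj
... | false = bcount≤1 m (p ∘ suc) (λ j l pj pl → suc-injective (unique (suc j) (suc l) pj pl))

∑≤n : ∀ n (f : Fin n → ℕ) → (∀ x → f x ≤ 1) → ∑ n f ≤ n
∑≤n zero    f f≤1 = z≤n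
∑≤n (suc n) f f≤1 = +-mono-≤ (f≤1 zero) (∑≤n n (f ∘ suc) (f≤1 ∘ suc))

∑==n≡allB : ∀ n (f : Fin n → ℕ) → (∀ x → f x ≤ 1) → (∑ n f == n) ≡ allB n (λ x → f x == 1)
∑==n≡allB zero    f f≤1 = refl
∑==n≡allB (suc n) f f≤1 with f zero | f≤1 zero
... | zero        | _       = dec-false (∑ n (f ∘ suc) ℕ.≟ suc n)
                                (λ e → 1+n≰n (subst (_≤ n) e (∑≤n n (f ∘ suc) (f≤1 ∘ suc))))
... | suc zero    | _       = ∑==n≡allB n (f ∘ suc) (f≤1 ∘ suc)
... | suc (suc _) | s≤s ()

FibresAreCliques : ∀ {k m} → CoverGraph k m → Set
FibresAreCliques H = ∀ x j l → ¬ j ≡ l → hadj H x j x l ≡ true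

independent-meets-fibre-once : ∀ {k m} (H : CoverGraph k m) → FibresAreCliques H →
  (S : Vec (Vec Bool m) k) → independent H S ≡ true →
  ∀ x j l → mem S x j ≡ true → mem S x l ≡ true → j ≡ l
independent-meets-fibre-once H cliques S ind x j l xj xl with j ≟ l
... | yes j≡l = j≡l
... | no  j≢l with independent-elim H S ind x j x l
...   | free rewrite xj | xl | cliques x j l j≢l with () ← free

isColoring≡onePerFibre∧independent : ∀ {k m} (H : CoverGraph k m) → FibresAreCliques H →
  (S : Vec (Vec Bool m) k) → isColoring H S ≡ onePerFibre S ∧ independent H S
isColoring≡onePerFibre∧independent {k} {m} H cliques S with independent H S in ind
... | false = sym (∧-zeroʳ (onePerFibre S))
... | true  = trans (∑==n≡allB k (bcount m ∘ mem S)
                       (λ x → bcount≤1 m (mem S x) (independent-meets-fibre-once H cliques S ind x)))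
                    (sym (∧-identityʳ _))

PDP≡∑V-proper : ∀ {k m} (H : CoverGraph k m) → FibresAreCliques H →
                PDP H ≡ ∑V m k (𝟙 ∘ proper H)
PDP≡∑V-proper {k} {m} H cliques = begin
  PDP H
    ≡⟨ length-filter≡∑L (isColoring H) (allSubsets k m) ⟩
  ∑L (allSubsets k m) (𝟙 ∘ isColoring H)
    ≡⟨ ∑L-cong (allSubsets k m) (λ S → trans (cong 𝟙 (isColoring≡onePerFibre∧independent H cliques S))
                                             (𝟙-∧ (onePerFibre S) _)) ⟩
  ∑L (allSubsets k m) (λ S → 𝟙 (onePerFibre S) * 𝟙 (independent H S))
    ≡⟨ ∑L-onePerFibre m k (𝟙 ∘ independent H) ⟩
  ∑V m k (𝟙 ∘ independent H ∘ map oneHot)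
    ≡⟨ ∑V-cong m k (cong 𝟙 ∘ independent-oneHot H) ⟩
  ∑V m k (𝟙 ∘ proper H) ∎
  where open ≡-Reasoning

Nv≡∑V-proper-insertAt : ∀ {k m} (H : CoverGraph (suc k) m) → FibresAreCliques H → ∀ x t →
                        Nv H x t ≡ ∑V m k (λ w → 𝟙 (proper H (insertAt w x t)))
Nv≡∑V-proper-insertAt {k} {m} H cliques x t = begin
  Nv H x t
    ≡⟨ length-filter≡∑L (λ S → mem S x t) (colorings H) ⟩
  ∑L (colorings H) (λ S → 𝟙 (mem S x t))
    ≡⟨ ∑L-filter (isColoring H) (allSubsets (suc k) m) _ ⟩
  ∑L (allSubsets (suc k) m) (λ S → 𝟙 (isColoring H S) * 𝟙 (mem S x t))
    ≡⟨ ∑L-cong (allSubsets (suc k) m) split-isColoring ⟩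
  ∑L (allSubsets (suc k) m) (λ S → 𝟙 (onePerFibre S) * (𝟙 (independent H S) * 𝟙 (mem S x t)))
    ≡⟨ ∑L-onePerFibre m (suc k) _ ⟩
  ∑V m (suc k) (λ c → 𝟙 (independent H (map oneHot c)) * 𝟙 (mem (map oneHot c) x t))
    ≡⟨ ∑V-cong m (suc k) (λ c → cong₂ (λ a b → 𝟙 a * 𝟙 b)
                                       (independent-oneHot H c) (mem-oneHot c x t)) ⟩
  ∑V m (suc k) (λ c → 𝟙 (proper H c) * picks-t (lookup c x))
    ≡⟨ ∑V-insertAt m k x (λ c → 𝟙 (proper H c) * picks-t (lookup c x)) ⟩
  ∑ m (λ s → ∑V m k (λ w → extends s w * picks-t (lookup (insertAt w x s) x)))
    ≡⟨ ∑-cong m pull-out ⟩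
  ∑ m (λ s → picks-t s * ∑V m k (extends s))
    ≡⟨ ∑-oneHot m t _ ⟩
  ∑V m k (extends t) ∎
  where
  open ≡-Reasoning
  picks-t : Fin m → ℕ
  picks-t s = 𝟙 (lookup (oneHot s) t)
  extends : Fin m → Vec (Fin m) k → ℕ
  extends s w = 𝟙 (proper H (insertAt w x s))
  split-isColoring : ∀ S → 𝟙 (isColoring H S) * 𝟙 (mem S x t)
                         ≡ 𝟙 (onePerFibre S) * (𝟙 (independent H S) * 𝟙 (mem S x t))
  split-isColoring S = begin
    𝟙 (isColoring H S) * 𝟙 (mem S x t)
      ≡⟨ cong (λ b → 𝟙 b * 𝟙 (mem S x t)) (isColoring≡onePerFibre∧independent H cliques S) ⟩
    𝟙 (onePerFibre S ∧ independent H S) * 𝟙 (mem S x t)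
      ≡⟨ cong (_* 𝟙 (mem S x t)) (𝟙-∧ (onePerFibre S) _) ⟩
    𝟙 (onePerFibre S) * 𝟙 (independent H S) * 𝟙 (mem S x t)
      ≡⟨ *-assoc (𝟙 (onePerFibre S)) _ _ ⟩
    𝟙 (onePerFibre S) * (𝟙 (independent H S) * 𝟙 (mem S x t)) ∎
  pull-out : ∀ s → ∑V m k (λ w → extends s w * picks-t (lookup (insertAt w x s) x))
                 ≡ picks-t s * ∑V m k (extends s)
  pull-out s = begin
    ∑V m k (λ w → extends s w * picks-t (lookup (insertAt w x s) x))
      ≡⟨ ∑V-cong m k (λ w → cong (λ z → extends s w * picks-t z) (insertAt-lookup w x s)) ⟩
    ∑V m k (λ w → extends s w * picks-t s)
      ≡⟨ ∑V-distribʳ-* m k (extends s) (picks-t s) ⟩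
    ∑V m k (extends s) * picks-t s
      ≡⟨ *-comm (∑V m k (extends s)) (picks-t s) ⟩
    picks-t s * ∑V m k (extends s) ∎

-- The amalgamated cover

module Amalgamation (r m : ℕ) (k : Fin (suc r) → ℕ)
                    (G : (i : Fin (suc r)) → Graph (suc (k i)))
                    (u : (i : Fin (suc r)) → Fin (suc (k i)))
                    (H : (i : Fin (suc r)) → CoverGraph (suc (k i)) m)
                    (HC : (i : Fin (suc r)) → IsCover (G i) m (H i))
                    (f : Fin r → Fin m ↔ Fin m) where

  N : ℕ
  N = suc r

  Outer : Set
  Outer = Σ (Fin N) λ i → Fin (k i)

  encode : Outer → Fin (∑ N k)
  encode = uncurry (unsplit N k)

  A : CoverGraph (suc (∑ N k)) m
  A = amalgamated r m k u H f

  adjA : Maybe Outer → Fin m → Maybe Outer → Fin m → Bool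
  adjA = amalgAdj r m k u H f

  vertex : (i : Fin N) → Fin (k i) → Fin (suc (k i))
  vertex i = punchIn (u i)

  vertex≢u : ∀ i y → ¬ vertex i y ≡ u i
  vertex≢u i = punchInᵢ≢i (u i)

  distinct-vertices : ∀ i y z → ¬ encode (i , y) ≡ encode (i , z) → ¬ vertex i y ≡ vertex i z
  distinct-vertices i y z ≢ e = ≢ (cong (unsplit N k i) (punchIn-injective (u i) y z e))

  adjA-same-block : ∀ i y z a b →
                    adjA (just (i , y)) a (just (i , z)) b ≡ hadj (H i) (vertex i y) a (vertex i z) b
  adjA-same-block i y z a b with i ≟ i
  ... | yes refl = refl
  ... | no  i≢i  = ⊥-elim (i≢i refl)

  A-vertex-u : ∀ i y a b →
    hadj A (suc (unsplit N k i y)) a zero b ≡ hadj (H i) (vertex i y) a (u i) (gF f i b)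
  A-vertex-u i y a b rewrite split-unsplit N k i y = refl

  A-u-vertex : ∀ i y a b →
    hadj A zero a (suc (unsplit N k i y)) b ≡ hadj (H i) (u i) (gF f i a) (vertex i y) b
  A-u-vertex i y a b rewrite split-unsplit N k i y = refl

  A-vertex-vertex : ∀ i y z a b →
    hadj A (suc (unsplit N k i y)) a (suc (unsplit N k i z)) b ≡ hadj (H i) (vertex i y) a (vertex i z) b
  A-vertex-vertex i y z a b rewrite split-unsplit N k i y | split-unsplit N k i z =
    adjA-same-block i y z a b

  gF-injective : ∀ i {a b} → gF f i a ≡ gF f i b → a ≡ b
  gF-injective zero    = id
  gF-injective (suc i) = Injection.injective (↔⇒↣ (f i))

  restrict : Fin m → Vec (Fin m) (∑ N k) → (i : Fin N) → Vec (Fin m) (suc (k i))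
  restrict s rest i = insertAt (block N k i rest) (u i) (gF f i s)

  restrict-u : ∀ s rest i → lookup (restrict s rest i) (u i) ≡ gF f i s
  restrict-u s rest i = insertAt-lookup (block N k i rest) (u i) (gF f i s)

  restrict-vertex : ∀ s rest i y → lookup (restrict s rest i) (vertex i y) ≡ lookup rest (unsplit N k i y)
  restrict-vertex s rest i y =
    trans (insertAt-punchIn (block N k i rest) (u i) (gF f i s) y) (lookup-block N k i rest y)

  module _ (s : Fin m) (rest : Vec (Fin m) (∑ N k)) where

    restrict-nonAdjacent : NonAdjacent A (s ∷ rest) → ∀ i → NonAdjacent (H i) (restrict s rest i)
    restrict-nonAdjacent nonadj i x y with punchInView (u i) x | punchInView (u i) y
    ... | at-i       | at-i       = IsCover.irrefl (HC i) (u i) _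
    ... | punched y  | at-i       rewrite restrict-vertex s rest i y | restrict-u s rest i =
      trans (sym (A-vertex-u i y _ s)) (nonadj (suc (unsplit N k i y)) zero)
    ... | at-i       | punched y  rewrite restrict-vertex s rest i y | restrict-u s rest i =
      trans (sym (A-u-vertex i y s _)) (nonadj zero (suc (unsplit N k i y)))
    ... | punched y  | punched z  rewrite restrict-vertex s rest i y | restrict-vertex s rest i z =
      trans (sym (A-vertex-vertex i y z _ _)) (nonadj (suc (unsplit N k i y)) (suc (unsplit N k i z)))

    module _ (nonadj : ∀ i → NonAdjacent (H i) (restrict s rest i)) where

      u-outer : ∀ p → adjA nothing s (just p) (lookup rest (encode p)) ≡ false
      u-outer (i , y) = subst₂ (λ t z → hadj (H i) (u i) t (vertex i y) z ≡ false)
        (restrict-u s rest i) (restrict-vertex s rest i y) (nonadj i (u i) (vertex i y))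

      outer-u : ∀ p → adjA (just p) (lookup rest (encode p)) nothing s ≡ false
      outer-u (i , y) = subst₂ (λ z t → hadj (H i) (vertex i y) z (u i) t ≡ false)
        (restrict-vertex s rest i y) (restrict-u s rest i) (nonadj i (vertex i y) (u i))

      outer-outer : ∀ p q →
                    adjA (just p) (lookup rest (encode p)) (just q) (lookup rest (encode q)) ≡ false
      outer-outer (i , y) (j , z) with i ≟ j
      ... | no  _    = refl
      ... | yes refl = subst₂ (λ t w → hadj (H i) (vertex i y) t (vertex i z) w ≡ false)
        (restrict-vertex s rest i y) (restrict-vertex s rest i z) (nonadj i (vertex i y) (vertex i z))

      amalgamated-nonAdjacent : NonAdjacent A (s ∷ rest)
      amalgamated-nonAdjacent zero    zero    = cong not (dec-true (s ≟ s) refl)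
      amalgamated-nonAdjacent zero    (suc b) =
        subst (λ b′ → adjA nothing s (just (split N k b)) (lookup rest b′) ≡ false)
              (unsplit-split N k b) (u-outer (split N k b))
      amalgamated-nonAdjacent (suc a) zero    =
        subst (λ a′ → adjA (just (split N k a)) (lookup rest a′) nothing s ≡ false)
              (unsplit-split N k a) (outer-u (split N k a))
      amalgamated-nonAdjacent (suc a) (suc b) =
        subst₂ (λ a′ b′ → adjA (just (split N k a)) (lookup rest a′)
                               (just (split N k b)) (lookup rest b′) ≡ false)
               (unsplit-split N k a) (unsplit-split N k b) (outer-outer (split N k a) (split N k b))

    proper-amalgamated : proper A (s ∷ rest) ≡ allB N (λ i → proper (H i) (restrict s rest i))
    proper-amalgamated = bool-ext ⇒ ⇐
      where
      pieces : Fin N → Bool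
      pieces i = proper (H i) (restrict s rest i)
      ⇒ : proper A (s ∷ rest) ≡ true → allB N pieces ≡ true
      ⇒ p = allB-intro N pieces λ i →
        proper-intro (H i) (restrict s rest i) (restrict-nonAdjacent (proper-elim A (s ∷ rest) p) i)
      ⇐ : allB N pieces ≡ true → proper A (s ∷ rest) ≡ true
      ⇐ p = proper-intro A (s ∷ rest) (amalgamated-nonAdjacent λ i →
        proper-elim (H i) (restrict s rest i) (allB-elim N pieces p i))

  cliquesA : FibresAreCliques A
  cliquesA zero    j l j≢l = cong not (dec-false (j ≟ l) j≢l)
  cliquesA (suc x) j l j≢l = outer (split N k x)
    where
    outer : (p : Outer) → adjA (just p) j (just p) l ≡ true
    outer (i , y) = trans (adjA-same-block i y y j l) (IsCover.clique (HC i) (vertex i y) j l j≢l)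

  PDP-amalgamated : PDP A ≡ ∑ m (λ s → ∏ N (λ i → Nv (H i) (u i) (gF f i s)))
  PDP-amalgamated = begin
    PDP A
      ≡⟨ PDP≡∑V-proper A cliquesA ⟩
    ∑ m (λ s → ∑V m (∑ N k) (λ rest → 𝟙 (proper A (s ∷ rest))))
      ≡⟨ ∑-cong m (λ s → ∑V-cong m (∑ N k) (λ rest →
           trans (cong 𝟙 (proper-amalgamated s rest))
                 (𝟙-allB N (λ i → proper (H i) (restrict s rest i))))) ⟩
    ∑ m (λ s → ∑V m (∑ N k) (λ rest → ∏ N (λ i → 𝟙 (proper (H i) (restrict s rest i)))))
      ≡⟨ ∑-cong m (λ s → ∑V-∏-blocks m N k (λ i w → extends i s w)) ⟩
    ∑ m (λ s → ∏ N (λ i → ∑V m (k i) (extends i s)))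
      ≡⟨ ∑-cong m (λ s → ∏-cong N (λ i →
           sym (Nv≡∑V-proper-insertAt (H i) (IsCover.clique (HC i)) (u i) (gF f i s)))) ⟩
    ∑ m (λ s → ∏ N (λ i → Nv (H i) (u i) (gF f i s))) ∎
    where
    open ≡-Reasoning
    extends : (i : Fin N) → Fin m → Vec (Fin m) (k i) → ℕ
    extends i s w = 𝟙 (proper (H i) (insertAt w (u i) (gF f i s)))

  adjA-sym : ∀ (p q : Maybe Outer) j l → adjA p j q l ≡ adjA q l p j
  adjA-sym nothing        nothing         j l = cong not (does-≟-sym j l)
  adjA-sym nothing        (just (i , y))  j l = IsCover.sym (HC i) _ _ _ _
  adjA-sym (just (i , y)) nothing         j l = IsCover.sym (HC i) _ _ _ _
  adjA-sym (just (i , y)) (just (i′ , z)) j l with i ≟ i′ | i′ ≟ i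
  ... | yes refl | yes refl = IsCover.sym (HC i) _ _ _ _
  ... | yes refl | no  i≢i  = ⊥-elim (i≢i refl)
  ... | no  i≢i  | yes refl = ⊥-elim (i≢i refl)
  ... | no  _    | no  _    = refl

  adjA-irrefl : ∀ (p : Maybe Outer) j → adjA p j p j ≡ false
  adjA-irrefl nothing        j = cong not (dec-true (j ≟ j) refl)
  adjA-irrefl (just (i , y)) j = trans (adjA-same-block i y y j j) (IsCover.irrefl (HC i) _ _)

  adjG : Maybe Outer → Maybe Outer → Bool
  adjG = gluedAdj N k G u

  edge-u-outer : ∀ j l p → adjA nothing j (just p) l ≡ true → adjG nothing (just p) ≡ true
  edge-u-outer j l (i , z) = IsCover.edgeG (HC i) (u i) _ (vertex i z) l (vertex≢u i z ∘ sym)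

  edge-outer-u : ∀ j l p → adjA (just p) j nothing l ≡ true → adjG (just p) nothing ≡ true
  edge-outer-u j l (i , z) = IsCover.edgeG (HC i) (vertex i z) j (u i) _ (vertex≢u i z)

  edge-outer-outer : ∀ j l p q → ¬ encode p ≡ encode q →
                     adjA (just p) j (just q) l ≡ true → adjG (just p) (just q) ≡ true
  edge-outer-outer j l (i , y) (i′ , z) ≢ e with i ≟ i′
  ... | no  _    with () ← e
  ... | yes refl = IsCover.edgeG (HC i) (vertex i y) j (vertex i z) l (distinct-vertices i y z ≢) e

  matching-u-outer : ∀ j l l′ p →
    adjA nothing j (just p) l ≡ true → adjA nothing j (just p) l′ ≡ true → l ≡ l′
  matching-u-outer j l l′ (i , z) = IsCover.matching (HC i) (u i) _ (vertex i z) l l′ (vertex≢u i z ∘ sym)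

  matching-outer-u : ∀ j l l′ p →
    adjA (just p) j nothing l ≡ true → adjA (just p) j nothing l′ ≡ true → l ≡ l′
  matching-outer-u j l l′ (i , z) e e′ =
    gF-injective i (IsCover.matching (HC i) (vertex i z) j (u i) _ _ (vertex≢u i z) e e′)

  matching-outer-outer : ∀ j l l′ p q → ¬ encode p ≡ encode q →
    adjA (just p) j (just q) l ≡ true → adjA (just p) j (just q) l′ ≡ true → l ≡ l′
  matching-outer-outer j l l′ (i , y) (i′ , z) ≢ e e′ with i ≟ i′
  ... | no  _    with () ← e
  ... | yes refl =
    IsCover.matching (HC i) (vertex i y) j (vertex i z) l l′ (distinct-vertices i y z ≢) e e′

  split-≢ : ∀ {a b} → ¬ suc a ≡ suc b → ¬ encode (split N k a) ≡ encode (split N k b)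
  split-≢ {a} {b} ≢ e = ≢ (cong suc (trans (sym (unsplit-split N k a)) (trans e (unsplit-split N k b))))

  amalgamated-edge⇒glued-edge : ∀ x j y l → ¬ x ≡ y → hadj A x j y l ≡ true → adj (glue N k G u) x y ≡ true
  amalgamated-edge⇒glued-edge zero    j zero    l x≢y = ⊥-elim (x≢y refl)
  amalgamated-edge⇒glued-edge zero    j (suc b) l x≢y = edge-u-outer j l (split N k b)
  amalgamated-edge⇒glued-edge (suc a) j zero    l x≢y = edge-outer-u j l (split N k a)
  amalgamated-edge⇒glued-edge (suc a) j (suc b) l x≢y =
    edge-outer-outer j l (split N k a) (split N k b) (split-≢ x≢y)

  amalgamated-matching : ∀ x j y l l′ → ¬ x ≡ y → hadj A x j y l ≡ true → hadj A x j y l′ ≡ true → l ≡ l′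
  amalgamated-matching zero    j zero    l l′ x≢y = ⊥-elim (x≢y refl)
  amalgamated-matching zero    j (suc b) l l′ x≢y = matching-u-outer j l l′ (split N k b)
  amalgamated-matching (suc a) j zero    l l′ x≢y = matching-outer-u j l l′ (split N k a)
  amalgamated-matching (suc a) j (suc b) l l′ x≢y =
    matching-outer-outer j l l′ (split N k a) (split N k b) (split-≢ x≢y)

  amalgamated-isCover : IsCover (glue N k G u) m A
  amalgamated-isCover = record
    { sym      = λ x j y l → adjA-sym (decode N k x) (decode N k y) j l
    ; irrefl   = λ x j → adjA-irrefl (decode N k x) j
    ; clique   = cliquesA
    ; edgeG    = amalgamated-edge⇒glued-edge
    ; matching = amalgamated-matching
    }

-- The sum in PDP-amalgamated is D on the
-- nose, as gF f zero is the identity.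
lemma3p3 : (r m : ℕ) → 2 ≤ suc r →
  (k : Fin (suc r) → ℕ) →
  (G : (i : Fin (suc r)) → Graph (suc (k i))) →
  ((i : Fin (suc r)) → IsSimple (G i)) →
  (u : (i : Fin (suc r)) → Fin (suc (k i))) →
  (H : (i : Fin (suc r)) → CoverGraph (suc (k i)) m) →
  ((i : Fin (suc r)) → IsCover (G i) m (H i)) →
  (f : Fin r → Fin m ↔ Fin m) →
  let D = ∑ m (λ j → Nv (H zero) (u zero) j
                     * ∏ r (λ i → Nv (H (suc i)) (u (suc i)) (Inverse.to (f i) j)))
  in PDP (amalgamated r m k u H f) ≡ D
     × PDPm≤ (glue (suc r) k G u) m D
lemma3p3 r m _ k G _ u H HC f =
  PDP-amalgamated , A , amalgamated-isCover , ≤-reflexive PDP-amalgamated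
  where open Amalgamation r m k G u H HC f
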